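{- (i) $g^3(C_4)=4$ and $g^3(C_7)=g^3(C_6)=g^3(C_5)=5$; (ii) $g^3(C_8)=6$ and $g^3(C_9)=7$; (iii) $g^3(C_{12})=g^3(C_{11})=g^3(C_{10})=7$.
   Context: $C_n$ denotes the cyclic group of order $n$. For a finite abelian group $G$ (written additively) and a positive integer $k$, the $k$-Harborth constant $g^k(G)$ is the smallest positive integer $t$ such that every subset $S\subseteq G$ with $|S|\ge t$ contains a subset $T$ with $|T|=k$ and $\sum_{x\in T}x=0$. -}

module Defs where

open import Data.Nat using (ℕ; zero; suc; _+_; _≤_)
open import Data.Nat.Divisibility using (_∣_)
open import Relation.Binary.PropositionalEquality using (_≡_)
open import Data.Product using (Σ; _×_)
open import Data.Vec using ([]; _∷_)
open import Data.Fin.Subset using (Subset; inside; outside; _⊆_; ∣_∣)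

-- The cyclic group C_n is modelled as Fin n = {0,…,n-1}, with the element
-- i ∈ Fin n representing the residue class of toℕ i modulo n.
-- A subset of C_n is a Subset n (characteristic vector).

sumFrom : ∀ {m} → ℕ → Subset m → ℕ
sumFrom k [] = 0
sumFrom k (inside ∷ p) = k + sumFrom (suc k) p
sumFrom k (outside ∷ p) = sumFrom (suc k) p

subsetSum : ∀ {n} → Subset n → ℕ
subsetSum = sumFrom 0

ZeroSum : ∀ {n} → Subset n → Set
ZeroSum {n} T = n ∣ subsetSum T

HarborthProp : (n k t : ℕ) → Set
HarborthProp n k t =
  (S : Subset n) → t ≤ ∣ S ∣ →
  Σ (Subset n) λ T → T ⊆ S × ∣ T ∣ ≡ k × ZeroSum T

HarborthConstant : (n k t : ℕ) → Set
HarborthConstant n k t =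
  1 ≤ t × HarborthProp n k t × ((t′ : ℕ) → 1 ≤ t′ → HarborthProp n k t′ → t ≤ t′)

{-# OPTIONS --safe #-}
module Submission where

-- Each value g³(Cₙ) = t is witnessed by an explicit subset of size t − 1
-- without three distinct elements summing to 0, which forces g³(Cₙ) ≥ t,
-- and by an exhaustive check that every subset of size at least t has such
-- a triple.  Enumerating only the k-element subsets of S keeps the check
-- feasible for n ≤ 12.

open import Defs
open import Data.Fin.Subset using (Side; Subset; inside; outside; _⊆_; ∣_∣)
open import Data.Fin.Subset.Properties using (_⊆?_; drop-∷-⊆)
open import Data.List using (List; []; _∷_; [_]; _++_; map)
open import Data.List.Membership.Propositional using (_∈_; find; lose)
open import Data.List.Membership.Propositional.Properties using (∈-map⁺; ∈-++⁺ˡ; ∈-++⁺ʳ)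
open import Data.List.Relation.Unary.Any using (here; any?)
open import Data.Nat using (ℕ; zero; suc; _<_; _≤?_; s≤s; z≤n)
open import Data.Nat.Divisibility using (_∣?_)
open import Data.Nat.Properties using (_≟_; suc-injective; ≰⇒>)
open import Data.Product using (∃; _×_; _,_; proj₂; map₂)
open import Data.Vec using ([]; _∷_)
import Data.Vec as Vec
open import Relation.Binary.PropositionalEquality using (_≡_; refl)
open import Relation.Nullary using (Dec; ¬_; _×-dec_; _→-dec_)
open import Relation.Nullary.Decidable using (True; False; map′; toWitness; toWitnessFalse)

HasZeroSumSubset : ∀ {n} → ℕ → Subset n → Set
HasZeroSumSubset k S = ∃ λ T → T ⊆ S × ∣ T ∣ ≡ k × ZeroSum T

subsetsOfSize : ∀ {n} → Subset n → ℕ → List (Subset n)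
subsetsOfSize []            zero    = [ [] ]
subsetsOfSize []            (suc k) = []
subsetsOfSize (outside ∷ S) k       = map (outside ∷_) (subsetsOfSize S k)
subsetsOfSize (inside ∷ S)  zero    = map (outside ∷_) (subsetsOfSize S zero)
subsetsOfSize (inside ∷ S)  (suc k) =
  map (inside ∷_) (subsetsOfSize S k) ++ map (outside ∷_) (subsetsOfSize S (suc k))

∈-subsetsOfSize : ∀ {n k} {T S : Subset n} → T ⊆ S → ∣ T ∣ ≡ k → T ∈ subsetsOfSize S k
∈-subsetsOfSize {k = zero}  {[]}          {[]}          _   refl = here refl
∈-subsetsOfSize {k = k}     {outside ∷ T} {outside ∷ S} T⊆S ∣T∣≡k =
  ∈-map⁺ _ (∈-subsetsOfSize (drop-∷-⊆ T⊆S) ∣T∣≡k)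
∈-subsetsOfSize {k = zero}  {outside ∷ T} {inside ∷ S}  T⊆S ∣T∣≡k =
  ∈-map⁺ _ (∈-subsetsOfSize (drop-∷-⊆ T⊆S) ∣T∣≡k)
∈-subsetsOfSize {k = suc k} {outside ∷ T} {inside ∷ S}  T⊆S ∣T∣≡k =
  ∈-++⁺ʳ _ (∈-map⁺ _ (∈-subsetsOfSize (drop-∷-⊆ T⊆S) ∣T∣≡k))
∈-subsetsOfSize {k = suc k} {inside ∷ T}  {inside ∷ S}  T⊆S ∣T∣≡k =
  ∈-++⁺ˡ (∈-map⁺ _ (∈-subsetsOfSize (drop-∷-⊆ T⊆S) (suc-injective ∣T∣≡k)))
∈-subsetsOfSize {T = inside ∷ T} {outside ∷ S} T⊆S _ with T⊆S Vec.here
... | ()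

hasZeroSumSubset? : ∀ {n} k (S : Subset n) → Dec (HasZeroSumSubset k S)
hasZeroSumSubset? {n} k S =
  map′ (λ any → map₂ proj₂ (find any))
       (λ { (T , T⊆S , ∣T∣≡k , zs) → lose (∈-subsetsOfSize T⊆S ∣T∣≡k) (T⊆S , ∣T∣≡k , zs) })
       (any? (λ T → T ⊆? S ×-dec ∣ T ∣ ≟ k ×-dec n ∣? subsetSum T) (subsetsOfSize S k))

allSubsets? : ∀ {n} {P : Subset n → Set} → (∀ S → Dec (P S)) → Dec (∀ S → P S)
allSubsets? {zero}  P? = map′ (λ { p [] → p }) (λ ∀P → ∀P []) (P? [])
allSubsets? {suc n} P? =
  map′ (λ { (∀P₁ , _) (inside ∷ S) → ∀P₁ S ; (_ , ∀P₀) (outside ∷ S) → ∀P₀ S })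
       (λ ∀P → (λ S → ∀P (inside ∷ S)) , (λ S → ∀P (outside ∷ S)))
       (allSubsets? (λ S → P? (inside ∷ S)) ×-dec allSubsets? (λ S → P? (outside ∷ S)))

harborthProp? : ∀ n k t → Dec (HarborthProp n k t)
harborthProp? n k t = allSubsets? (λ S → t ≤? ∣ S ∣ →-dec hasZeroSumSubset? k S)

∣zeroSumFree∣<harborth : ∀ {n k t} (S : Subset n) → ¬ HasZeroSumSubset k S →
                         HarborthProp n k t → ∣ S ∣ < t
∣zeroSumFree∣<harborth S ¬zs prop = ≰⇒> (λ t≤∣S∣ → ¬zs (prop S t≤∣S∣))

harborthConstant : ∀ {n k} (S : Subset n) → ¬ HasZeroSumSubset k S →
                   HarborthProp n k (suc ∣ S ∣) → HarborthConstant n k (suc ∣ S ∣)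
harborthConstant S ¬zs prop =
  s≤s z≤n , prop , λ t′ _ prop′ → ∣zeroSumFree∣<harborth S ¬zs prop′

harborthConstant-by-computation :
  ∀ {n k} (S : Subset n) →
  {False (hasZeroSumSubset? k S)} → {True (harborthProp? n k (suc ∣ S ∣))} →
  HarborthConstant n k (suc ∣ S ∣)
harborthConstant-by-computation S {¬zs} {prop} =
  harborthConstant S (toWitnessFalse ¬zs) (toWitness prop)

private
  I O : Side
  I = inside
  O = outside

proposition3p15 : (HarborthConstant 4 3 4 × HarborthConstant 7 3 5 × HarborthConstant 6 3 5 × HarborthConstant 5 3 5)
    × (HarborthConstant 8 3 6 × HarborthConstant 9 3 7)
    × (HarborthConstant 12 3 7 × HarborthConstant 11 3 7 × HarborthConstant 10 3 7)
proposition3p15 =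
  ( harborthConstant-by-computation (I ∷ I ∷ I ∷ O ∷ [])
  , harborthConstant-by-computation (I ∷ I ∷ I ∷ I ∷ O ∷ O ∷ O ∷ [])
  , harborthConstant-by-computation (I ∷ I ∷ O ∷ I ∷ I ∷ O ∷ [])
  , harborthConstant-by-computation (O ∷ I ∷ I ∷ I ∷ I ∷ []) )
  , ( harborthConstant-by-computation (I ∷ I ∷ O ∷ O ∷ I ∷ I ∷ I ∷ O ∷ [])
    , harborthConstant-by-computation (O ∷ I ∷ I ∷ O ∷ I ∷ I ∷ O ∷ I ∷ I ∷ []) )
  , ( harborthConstant-by-computation (I ∷ I ∷ I ∷ O ∷ O ∷ O ∷ I ∷ I ∷ I ∷ O ∷ O ∷ O ∷ [])
    , harborthConstant-by-computation (I ∷ I ∷ O ∷ I ∷ I ∷ I ∷ O ∷ O ∷ O ∷ I ∷ O ∷ [])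
    , harborthConstant-by-computation (O ∷ I ∷ I ∷ O ∷ I ∷ O ∷ I ∷ O ∷ I ∷ I ∷ []) )
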